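{- Let $a$ and $k$ be positive integers with $k>\lambda(a)+1$. The smallest multiple $n$ of $a$ with $\lambda(n)=k$ is $a\,g(k-\lambda(a))$. If $a$ is odd, then the only multiple $n$ of $a$ with $\lambda(n)=\lambda(a)+1$ is $4a$. If $a$ is even, then the only multiple $n$ of $a$ with $\lambda(n)=\lambda(a)+1$ is $2a$.
   Context: Let $\overline{\psi}$ be the multiplicative arithmetic function with $\overline{\psi}(p^{\alpha})=p^{\alpha-1}(p+1)$ for odd primes $p$ and $\overline{\psi}(2^{\alpha})=2^{\alpha-1}$, for all positive integers $\alpha$ (so $\overline{\psi}(1)=1$). For $n>1$, $\lambda(n)$ is the unique nonnegative integer with $\overline{\psi}^{\lambda(n)}(n)=2$ (where $\overline{\psi}^k$ is the $k$-th iterate, $\overline{\psi}^0(n)=n$), and $\lambda(1)=0$. Define $g(k)$ for integers $k\geq 2$ by $g(k)=5^{k/3}$ if $k\equiv 0\pmod 3$, $g(k)=9\cdot 5^{(k-4)/3}$ if $k\equiv 1\pmod 3$, and $g(k)=3\cdot 5^{(k-2)/3}$ if $k\equiv 2\pmod 3$. -}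

module Defs where

open import Data.Nat using (ℕ; zero; suc; _+_; _*_; _∸_; _^_; _<_; _≡ᵇ_)
open import Data.Nat.DivMod using (_/_; _%_)
open import Data.Nat.Divisibility using (_∣_)
open import Data.Nat.Primality using (Prime)
open import Data.Nat.Coprimality using (Coprime)
open import Data.Product using (_×_)
open import Data.Sum using (_⊎_)
open import Relation.Binary.PropositionalEquality using (_≡_)
open import Relation.Nullary using (¬_)

-- ψ̄ is characterised as in the paper: the multiplicative arithmetic function
-- with ψ̄(p^α) = p^(α-1)(p+1) for odd primes p, ψ̄(2^α) = 2^(α-1), ψ̄(1) = 1.
-- (This determines ψ̄ uniquely on positive integers; the value at 0 is irrelevant.)
record IsPsiBar (ψ : ℕ → ℕ) : Set where
  field
    one    : ψ 1 ≡ 1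
    mult   : ∀ m n → Coprime m n → ψ (m * n) ≡ ψ m * ψ n
    oddPP  : ∀ p α → Prime p → ¬ (2 ∣ p) → ψ (p ^ suc α) ≡ p ^ α * (p + 1)
    twoPP  : ∀ α → ψ (2 ^ suc α) ≡ 2 ^ α

iter : (ℕ → ℕ) → ℕ → ℕ → ℕ
iter f zero    n = n
iter f (suc k) n = f (iter f k n)

IsLambda : (ℕ → ℕ) → ℕ → ℕ → Set
IsLambda ψ n k = (n ≡ 1 × k ≡ 0) ⊎ (1 < n × iter ψ k n ≡ 2)

-- g(k) for k ≥ 2
g : ℕ → ℕ
g k with k % 3
... | 0 = 5 ^ (k / 3)
... | 1 = 9 * 5 ^ ((k ∸ 4) / 3)
... | _ = 3 * 5 ^ ((k ∸ 2) / 3)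

-- Let H be the completely additive function with H(2) = 1 and H(p) = H(p + 1) for odd
-- primes p. Since ψ̄(p^α) = p^(α-1)(p + 1) and ψ̄(2^α) = 2^(α-1), the map ψ̄ keeps H on odd
-- numbers and lowers it by one on even numbers; moreover ψ̄(n) is even for n > 2, and 2 is
-- the only number of height 1. Hence λ(n) = H(n) - 1 for even n and λ(n) = H(n) for odd n.
-- For a multiple n = a b we have H(n) = H(a) + H(b), so everything reduces to the fact that
-- the least number of height j ≥ 2 is the odd number g(j), which follows by induction on the
-- factorisation from g(i + j) ≤ g(i) g(j) and g(H(p)) ≤ p for primes p.

{-# OPTIONS --safe #-}
module Submission where

open import Data.Nat
open import Data.Nat.Coprimality using (Coprime; coprime-divisor; 1-coprimeTo)
open import Data.Nat.Divisibility
open import Data.Nat.DivMod using ([m+n]%n≡m%n; m/n≡1+[m∸n]/n)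
open import Data.Nat.Induction using (<-rec)
open import Data.Nat.Primality
open import Data.Nat.Properties
open import Algebra.Properties.CommutativeSemigroup *-commutativeSemigroup using (x∙yz≈y∙xz)
open import Data.Product using (∃; ∃₂; _×_; _,_; zip)
open import Data.Sum using (_⊎_; inj₁; inj₂; [_,_]′)
open import Function using (_∘_; id)
open import Relation.Binary.PropositionalEquality
open import Relation.Nullary using (¬_; yes; no; contradiction)
open import Relation.Nullary.Decidable using (from-yes; from-no)

open import Defs

private
  variable
    a b c d e h i j k l m n p x : ℕ

2∤1 : ¬ 2 ∣ 1
2∤1 2∣1 = contradiction (∣1⇒≡1 2∣1) λ ()

2∣⊎2∣suc : ∀ n → 2 ∣ n ⊎ 2 ∣ suc n
2∣⊎2∣suc zero = inj₁ (divides 0 refl)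
2∣⊎2∣suc (suc n) with 2∣⊎2∣suc n
... | inj₁ 2∣n   = inj₂ (∣m∣n⇒∣m+n ∣-refl 2∣n)
... | inj₂ 2∣1+n = inj₁ 2∣1+n

odd⇒2∣+1 : ¬ 2 ∣ n → 2 ∣ n + 1
odd⇒2∣+1 {n} n-odd with 2∣⊎2∣suc n
... | inj₁ 2∣n   = contradiction 2∣n n-odd
... | inj₂ 2∣1+n = subst (2 ∣_) (+-comm 1 n) 2∣1+n

odd-* : ¬ 2 ∣ m → ¬ 2 ∣ n → ¬ 2 ∣ m * n
odd-* {m} {n} m-odd n-odd 2∣mn = [ m-odd , n-odd ]′ (euclidsLemma m n prime[2] 2∣mn)

2∣*-oddˡ : ¬ 2 ∣ m → 2 ∣ m * n → 2 ∣ n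
2∣*-oddˡ {m} {n} m-odd 2∣mn = [ (λ 2∣m → contradiction 2∣m m-odd) , id ]′ (euclidsLemma m n prime[2] 2∣mn)

odd∧1<⇒2< : ¬ 2 ∣ n → 1 < n → 2 < n
odd∧1<⇒2< n-odd 1<n = ≤∧≢⇒< 1<n λ 2≡n → n-odd (subst (2 ∣_) 2≡n ∣-refl)

odd≤+1⇒≤ : ¬ 2 ∣ m → 2 ∣ n + 1 → m ≤ n + 1 → m ≤ n
odd≤+1⇒≤ {m} {n} m-odd 2∣n+1 m≤n+1 =
  m<1+n⇒m≤n (subst (m <_) (+-comm n 1) (≤∧≢⇒< m≤n+1 λ m≡n+1 → m-odd (subst (2 ∣_) (sym m≡n+1) 2∣n+1)))

prime⇒1< : Prime p → 1 < p
prime⇒1< {p} pr = nonTrivial⇒n>1 p {{prime⇒nonTrivial pr}}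

2∣prime⇒≡2 : Prime p → 2 ∣ p → p ≡ 2
2∣prime⇒≡2 pr 2∣p with prime⇒irreducible pr 2∣p
... | inj₁ ()
... | inj₂ 2≡p = sym 2≡p

cofactor : 0 < n → d ∣ n → ∃ λ e → 0 < e × n ≡ d * e
cofactor 0<n d∣n =
  quotient d∣n , >-nonZero⁻¹ _ {{quotient≢0 d∣n {{>-nonZero 0<n}}}} , m∣n⇒n≡m*quotient d∣n

m+1<n⇒2≤n∸m : m + 1 < n → 2 ≤ n ∸ m
m+1<n⇒2≤n∸m {m} {n} m+1<n = m+n≤o⇒m≤o∸n 2 (subst (_≤ n) (cong suc (+-comm m 1)) m+1<n)

cofactor-< : 1 < d → 0 < e → e < d * e
cofactor-< {d} {e} 1<d 0<e = subst (e <_) (*-comm e d) (m<m*n e d {{>-nonZero 0<e}} 1<d)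

prime∤⇒coprime : Prime p → ¬ p ∣ m → Coprime p m
prime∤⇒coprime pr p∤m (d∣p , d∣m) with prime⇒irreducible pr d∣p
... | inj₁ d≡1 = d≡1
... | inj₂ refl = contradiction d∣m p∤m

coprime-* : Coprime m e → Coprime n e → Coprime (m * n) e
coprime-* m⊥e n⊥e (d∣mn , d∣e) =
  n⊥e (coprime-divisor (λ { (c∣d , c∣m) → m⊥e (c∣m , ∣-trans c∣d d∣e) }) d∣mn , d∣e)

coprime-^ : Coprime m n → ∀ α → Coprime (m ^ α) n
coprime-^ {n = n} _ zero = 1-coprimeTo n
coprime-^ m⊥n (suc α) = coprime-* m⊥n (coprime-^ m⊥n α)

prime-power-split : Prime p → ∀ m → 0 < m → ∃₂ λ α m′ → m ≡ p ^ α * m′ × ¬ p ∣ m′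
prime-power-split {p} pr = <-rec P split
  where
    P : ℕ → Set
    P m = 0 < m → ∃₂ λ α m′ → m ≡ p ^ α * m′ × ¬ p ∣ m′

    split : ∀ m → (∀ {q} → q < m → P q) → P m
    split m rec 0<m with p ∣? m
    ... | no p∤m = 0 , m , sym (*-identityˡ m) , p∤m
    ... | yes p∣m with cofactor 0<m p∣m
    ...   | q , 0<q , refl with rec (cofactor-< (prime⇒1< pr) 0<q) 0<q
    ...     | α , m′ , refl , p∤m′ = suc α , m′ , sym (*-assoc p (p ^ α) m′) , p∤m′

-- Height n j says H(n) = j for the completely additive H with H(2) = 1
-- and H(p) = H(p + 1) for odd primes p.
data Height : ℕ → ℕ → Set where
  unit     : Height 1 0
  double   : Height m j → Height (2 * m) (suc j)
  oddPrime : Prime p → ¬ 2 ∣ p → Height (p + 1) a → Height m b → Height (p * m) (a + b)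

height-cong : m ≡ n → Height m j → Height n j
height-cong refl h = h

height-* : Height m i → Height n j → Height (m * n) (i + j)
height-* unit hn = height-cong (sym (*-identityˡ _)) hn
height-* (double {m} hm) hn = height-cong (sym (*-assoc 2 m _)) (double (height-* hm hn))
height-* (oddPrime {p} {a} {m} {b} pr p-odd hp+1 hm) hn =
  subst (Height _) (sym (+-assoc a b _))
    (height-cong (sym (*-assoc p m _)) (oddPrime pr p-odd hp+1 (height-* hm hn)))

oddPrime-half< : Prime p → p + 1 ≡ 2 * h → h < p
oddPrime-half< {p} {h} pr p+1≡2h = *-cancelˡ-< 2 h p (begin-strict
  2 * h  ≡⟨ sym p+1≡2h ⟩
  p + 1  <⟨ +-monoʳ-< p (prime⇒1< pr) ⟩
  p + p  ≡⟨ cong (p +_) (sym (+-identityʳ p)) ⟩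
  2 * p  ∎)
  where open ≤-Reasoning

∃-height-prime : Prime p → (∀ {h} → h < p → 0 < h → ∃ (Height h)) → ∃ (Height p)
∃-height-prime {p} pr rec with 2 ∣? p
... | yes 2∣p = 1 , height-cong (sym (2∣prime⇒≡2 pr 2∣p)) (double unit)
... | no p-odd with cofactor (m≤n+m 1 p) (odd⇒2∣+1 p-odd)
...   | h , 0<h , p+1≡2h with rec (oddPrime-half< pr p+1≡2h) 0<h
...     | x , hh = suc x + 0 ,
  height-cong (*-identityʳ p) (oddPrime pr p-odd (height-cong (sym p+1≡2h) (double hh)) unit)

∃-height : ∀ n → 0 < n → ∃ (Height n)
∃-height = <-rec (λ n → 0 < n → ∃ (Height n)) step
  where
    step : ∀ n → (∀ {m} → m < n → 0 < m → ∃ (Height m)) → 0 < n → ∃ (Height n)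
    step 1 _ _ = 0 , unit
    step n@(suc (suc _)) rec 0<n with prime? n
    ... | yes pr = ∃-height-prime pr rec
    ... | no ¬pr with ¬prime⇒composite ¬pr
    ...   | composite {d} d<n d∣n with cofactor 0<n d∣n
    ...     | e , 0<e , n≡de =
      subst (∃ ∘ Height) (sym n≡de) (zip _+_ height-* (rec d<n (<-trans z<s 1<d)) (rec e<n 0<e))
      where
        1<d : 1 < d
        1<d = nonTrivial⇒n>1 d
        e<n : e < n
        e<n = subst (e <_) (sym n≡de) (cofactor-< 1<d 0<e)

prime⇒1<+1 : Prime p → 1 < p + 1
prime⇒1<+1 {p} pr = ≤-trans (prime⇒1< pr) (m≤m+n p 1)

height-0 : Height n j → j ≡ 0 → n ≡ 1
height-0 unit _ = refl
height-0 (oddPrime {p} {a} pr _ hp+1 _) a+b≡0 =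
  contradiction (height-0 hp+1 (m+n≡0⇒m≡0 a a+b≡0)) (>⇒≢ (prime⇒1<+1 pr))

height-1 : Height n j → j ≡ 1 → n ≡ 2
height-1 (double hm) refl = cong (2 *_) (height-0 hm refl)
height-1 (oddPrime {p} {zero} pr _ hp+1 _) _ =
  contradiction (height-0 hp+1 refl) (>⇒≢ (prime⇒1<+1 pr))
height-1 (oddPrime {p} {suc zero} pr _ hp+1 _) _ =
  contradiction (height-1 hp+1 refl) (>⇒≢ (+-monoˡ-≤ 1 (prime⇒1< pr)))
height-1 (oddPrime {a = suc (suc _)} _ _ _ _) ()

even⇒0<height : Height n j → 2 ∣ n → 0 < j
even⇒0<height {j = zero} h 2∣n = contradiction (subst (2 ∣_) (height-0 h refl) 2∣n) 2∤1
even⇒0<height {j = suc _} _ _ = s≤s z≤n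

-- The least number of each height

-- g′ agrees with g from 2 on (g≡g′); the recursion g(j + 3) = 5 g(j) replaces the
-- case split on j mod 3, and g′ 0 = 1, g′ 1 = 2 make g′ j the least number of height j
-- for every j.
g′ : ℕ → ℕ
g′ 0 = 1
g′ 1 = 2
g′ 2 = 3
g′ 3 = 5
g′ 4 = 9
g′ (suc (suc (suc (suc (suc j))))) = 5 * g′ (suc (suc j))

5*-≤-*5* : ∀ {x} c y → x ≤ c * y → 5 * x ≤ c * (5 * y)
5*-≤-*5* c y x≤cy = ≤-trans (*-monoʳ-≤ 5 x≤cy) (≤-reflexive (sym (x∙yz≈y∙xz c 5 y)))

g′[j]≤g′[1+j] : ∀ j → g′ j ≤ g′ (suc j)
g′[j]≤g′[1+j] 0 = ≤ᵇ⇒≤ _ _ _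
g′[j]≤g′[1+j] 1 = ≤ᵇ⇒≤ _ _ _
g′[j]≤g′[1+j] 2 = ≤ᵇ⇒≤ _ _ _
g′[j]≤g′[1+j] 3 = ≤ᵇ⇒≤ _ _ _
g′[j]≤g′[1+j] 4 = ≤ᵇ⇒≤ _ _ _
g′[j]≤g′[1+j] (suc (suc (suc (suc (suc j))))) = *-monoʳ-≤ 5 (g′[j]≤g′[1+j] (suc (suc j)))

g′-mono-≤ : i ≤ j → g′ i ≤ g′ j
g′-mono-≤ {j = zero} z≤n = ≤-refl
g′-mono-≤ {j = suc j} i≤1+j with m≤n⇒m<n∨m≡n i≤1+j
... | inj₁ i<1+j = ≤-trans (g′-mono-≤ (m<1+n⇒m≤n i<1+j)) (g′[j]≤g′[1+j] j)
... | inj₂ refl  = ≤-refl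

g′[1+j]≤2*g′[j] : ∀ j → g′ (suc j) ≤ 2 * g′ j
g′[1+j]≤2*g′[j] 0 = ≤ᵇ⇒≤ _ _ _
g′[1+j]≤2*g′[j] 1 = ≤ᵇ⇒≤ _ _ _
g′[1+j]≤2*g′[j] 2 = ≤ᵇ⇒≤ _ _ _
g′[1+j]≤2*g′[j] 3 = ≤ᵇ⇒≤ _ _ _
g′[1+j]≤2*g′[j] 4 = ≤ᵇ⇒≤ _ _ _
g′[1+j]≤2*g′[j] (suc (suc (suc (suc (suc j))))) = 5*-≤-*5* 2 (g′ (suc (suc j))) (g′[1+j]≤2*g′[j] (suc (suc j)))

-- Past 4, decreasing i or j by 3 divides both sides by 5, which leaves the cases i, j ≤ 4.
g′[i+j]≤g′[i]*g′[j] : ∀ i j → g′ (i + j) ≤ g′ i * g′ j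
g′[i+j]≤g′[i]*g′[j] 0 j = ≤-reflexive (sym (*-identityˡ (g′ j)))
g′[i+j]≤g′[i]*g′[j] i 0 = ≤-reflexive (trans (cong g′ (+-identityʳ i)) (sym (*-identityʳ (g′ i))))
g′[i+j]≤g′[i]*g′[j] (suc (suc (suc (suc (suc i))))) j =
  ≤-trans (*-monoʳ-≤ 5 (g′[i+j]≤g′[i]*g′[j] (suc (suc i)) j)) (≤-reflexive (sym (*-assoc 5 (g′ (suc (suc i))) (g′ j))))
g′[i+j]≤g′[i]*g′[j] 1 (suc (suc (suc (suc (suc j))))) = 5*-≤-*5* 2 (g′ (suc (suc j))) (g′[i+j]≤g′[i]*g′[j] 1 (suc (suc j)))
g′[i+j]≤g′[i]*g′[j] 2 (suc (suc (suc (suc (suc j))))) = 5*-≤-*5* 3 (g′ (suc (suc j))) (g′[i+j]≤g′[i]*g′[j] 2 (suc (suc j)))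
g′[i+j]≤g′[i]*g′[j] 3 (suc (suc (suc (suc (suc j))))) = 5*-≤-*5* 5 (g′ (suc (suc j))) (g′[i+j]≤g′[i]*g′[j] 3 (suc (suc j)))
g′[i+j]≤g′[i]*g′[j] 4 (suc (suc (suc (suc (suc j))))) = 5*-≤-*5* 9 (g′ (suc (suc j))) (g′[i+j]≤g′[i]*g′[j] 4 (suc (suc j)))
g′[i+j]≤g′[i]*g′[j] 1 1 = ≤ᵇ⇒≤ _ _ _
g′[i+j]≤g′[i]*g′[j] 1 2 = ≤ᵇ⇒≤ _ _ _
g′[i+j]≤g′[i]*g′[j] 1 3 = ≤ᵇ⇒≤ _ _ _
g′[i+j]≤g′[i]*g′[j] 1 4 = ≤ᵇ⇒≤ _ _ _
g′[i+j]≤g′[i]*g′[j] 2 1 = ≤ᵇ⇒≤ _ _ _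
g′[i+j]≤g′[i]*g′[j] 2 2 = ≤ᵇ⇒≤ _ _ _
g′[i+j]≤g′[i]*g′[j] 2 3 = ≤ᵇ⇒≤ _ _ _
g′[i+j]≤g′[i]*g′[j] 2 4 = ≤ᵇ⇒≤ _ _ _
g′[i+j]≤g′[i]*g′[j] 3 1 = ≤ᵇ⇒≤ _ _ _
g′[i+j]≤g′[i]*g′[j] 3 2 = ≤ᵇ⇒≤ _ _ _
g′[i+j]≤g′[i]*g′[j] 3 3 = ≤ᵇ⇒≤ _ _ _
g′[i+j]≤g′[i]*g′[j] 3 4 = ≤ᵇ⇒≤ _ _ _
g′[i+j]≤g′[i]*g′[j] 4 1 = ≤ᵇ⇒≤ _ _ _
g′[i+j]≤g′[i]*g′[j] 4 2 = ≤ᵇ⇒≤ _ _ _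
g′[i+j]≤g′[i]*g′[j] 4 3 = ≤ᵇ⇒≤ _ _ _
g′[i+j]≤g′[i]*g′[j] 4 4 = ≤ᵇ⇒≤ _ _ _

g′-odd : 2 ≤ j → ¬ 2 ∣ g′ j
g′-odd {1} (s≤s ())
g′-odd {2} _ = from-no (2 ∣? 3)
g′-odd {3} _ = from-no (2 ∣? 5)
g′-odd {4} _ = from-no (2 ∣? 9)
g′-odd {suc (suc (suc (suc (suc j))))} _ = odd-* (from-no (2 ∣? 5)) (g′-odd {suc (suc j)} (s≤s (s≤s z≤n)))

height-3 : Height 3 2
height-3 = oddPrime (from-yes (prime? 3)) (from-no (2 ∣? 3)) (double (double unit)) unit

height-5 : Height 5 3
height-5 = oddPrime (from-yes (prime? 5)) (from-no (2 ∣? 5)) (double height-3) unit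

height-g′ : ∀ j → Height (g′ j) j
height-g′ 0 = unit
height-g′ 1 = double unit
height-g′ 2 = height-3
height-g′ 3 = height-5
height-g′ 4 = height-* height-3 height-3
height-g′ (suc (suc (suc (suc (suc j))))) = height-* height-5 (height-g′ (suc (suc j)))

g′≤oddPrime : Prime p → ¬ 2 ∣ p → g′ a ≤ p + 1 → g′ a ≤ p
g′≤oddPrime {a = 0} pr _ _ = <⇒≤ (prime⇒1< pr)
g′≤oddPrime {a = 1} pr _ _ = prime⇒1< pr
g′≤oddPrime {a = suc (suc a)} _ p-odd g′a≤p+1 =
  odd≤+1⇒≤ (g′-odd {suc (suc a)} (s≤s (s≤s z≤n))) (odd⇒2∣+1 p-odd) g′a≤p+1

g′-least : Height n j → g′ j ≤ n
g′-least unit = ≤-refl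
g′-least (double {j = j} hm) = ≤-trans (g′[1+j]≤2*g′[j] j) (*-monoʳ-≤ 2 (g′-least hm))
g′-least (oddPrime {a = a} {b = b} pr p-odd hp+1 hm) =
  ≤-trans (g′[i+j]≤g′[i]*g′[j] a b) (*-mono-≤ (g′≤oddPrime {a = a} pr p-odd (g′-least hp+1)) (g′-least hm))

height⇒g′≤ : Height n j → i ≤ j → g′ i ≤ n
height⇒g′≤ h i≤j = ≤-trans (g′-mono-≤ i≤j) (g′-least h)

height⇒0< : Height n j → 0 < n
height⇒0< h = height⇒g′≤ h z≤n

-- The branches of g, selected by an explicit residue so that g unfolds at symbolic arguments.
g-branch : ℕ → ℕ → ℕ
g-branch 0 k = 5 ^ (k / 3)
g-branch 1 k = 9 * 5 ^ ((k ∸ 4) / 3)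
g-branch (suc (suc _)) k = 3 * 5 ^ ((k ∸ 2) / 3)

g≡g-branch : ∀ k → g k ≡ g-branch (k % 3) k
g≡g-branch k with k % 3
... | 0 = refl
... | 1 = refl
... | suc (suc _) = refl

[3+m]/3≡1+m/3 : ∀ m → (3 + m) / 3 ≡ suc (m / 3)
[3+m]/3≡1+m/3 m = m/n≡1+[m∸n]/n {3 + m} {3} (s≤s (s≤s (s≤s z≤n)))

[3+m]%3≡m%3 : ∀ m → (3 + m) % 3 ≡ m % 3
[3+m]%3≡m%3 m = trans (cong (_% 3) (+-comm 3 m)) ([m+n]%n≡m%n m 3)

g-branch-3+ : ∀ r y → (2 + y) % 3 ≡ r → g-branch r (5 + y) ≡ 5 * g-branch r (2 + y)
g-branch-3+ 0 y _ = cong (5 ^_) ([3+m]/3≡1+m/3 (2 + y))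
g-branch-3+ 1 (suc (suc y)) _ =
  trans (cong (λ e → 9 * 5 ^ e) ([3+m]/3≡1+m/3 y)) (x∙yz≈y∙xz 9 5 (5 ^ (y / 3)))
g-branch-3+ (suc (suc _)) y _ =
  trans (cong (λ e → 3 * 5 ^ e) ([3+m]/3≡1+m/3 y)) (x∙yz≈y∙xz 3 5 (5 ^ (y / 3)))

g-5+ : ∀ y → g (5 + y) ≡ 5 * g (2 + y)
g-5+ y = begin
  g (5 + y)                          ≡⟨ g≡g-branch (5 + y) ⟩
  g-branch ((5 + y) % 3) (5 + y)     ≡⟨ cong (λ r → g-branch r (5 + y)) ([3+m]%3≡m%3 (2 + y)) ⟩
  g-branch ((2 + y) % 3) (5 + y)     ≡⟨ g-branch-3+ _ y refl ⟩
  5 * g-branch ((2 + y) % 3) (2 + y) ≡⟨ cong (5 *_) (sym (g≡g-branch (2 + y))) ⟩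
  5 * g (2 + y)                      ∎
  where open ≡-Reasoning

g≡g′ : 2 ≤ j → g j ≡ g′ j
g≡g′ {1} (s≤s ())
g≡g′ {2} _ = refl
g≡g′ {3} _ = refl
g≡g′ {4} _ = refl
g≡g′ {suc (suc (suc (suc (suc j))))} _ = trans (g-5+ j) (cong (5 *_) (g≡g′ {suc (suc j)} (s≤s (s≤s z≤n))))

iter-suc : ∀ (f : ℕ → ℕ) k n → iter f (suc k) n ≡ iter f k (f n)
iter-suc f zero n = refl
iter-suc f (suc k) n = cong f (iter-suc f k n)

iter-fixed : ∀ {f : ℕ → ℕ} → f x ≡ x → ∀ k → iter f k x ≡ x
iter-fixed fx≡x zero = refl
iter-fixed {f = f} fx≡x (suc k) = trans (cong f (iter-fixed fx≡x k)) fx≡x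

module _ {f : ℕ → ℕ} (f1≡1 : f 1 ≡ 1) (f2≡1 : f 2 ≡ 1) where

  iter-suc-2 : ∀ k → iter f (suc k) 2 ≡ 1
  iter-suc-2 k = trans (iter-suc f k 2) (trans (cong (iter f k) f2≡1) (iter-fixed f1≡1 k))

  iter≡2-unique : ∀ i j → iter f i n ≡ 2 → iter f j n ≡ 2 → i ≡ j
  iter≡2-unique zero zero _ _ = refl
  iter≡2-unique zero (suc j) refl e = contradiction (trans (sym e) (iter-suc-2 j)) λ ()
  iter≡2-unique (suc i) zero e refl = contradiction (trans (sym e) (iter-suc-2 i)) λ ()
  iter≡2-unique {n} (suc i) (suc j) e e′ =
    cong suc (iter≡2-unique i j (trans (sym (iter-suc f i n)) e) (trans (sym (iter-suc f j n)) e′))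

  IsLambda-unique : IsLambda f n k → IsLambda f n l → k ≡ l
  IsLambda-unique (inj₁ (_ , refl)) (inj₁ (_ , refl)) = refl
  IsLambda-unique (inj₁ (refl , _)) (inj₂ (1<1 , _)) = contradiction 1<1 (<-irrefl refl)
  IsLambda-unique (inj₂ (1<1 , _)) (inj₁ (refl , _)) = contradiction 1<1 (<-irrefl refl)
  IsLambda-unique (inj₂ (_ , e)) (inj₂ (_ , e′)) = iter≡2-unique _ _ e e′

-- ψ̄ and heights

module _ {ψ : ℕ → ℕ} (isψ : IsPsiBar ψ) where
  open IsPsiBar isψ

  ψ-odd-prime : Prime p → ¬ 2 ∣ p → ψ p ≡ p + 1
  ψ-odd-prime {p} pr p-odd = begin
    ψ p              ≡⟨ cong ψ (sym (*-identityʳ p)) ⟩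
    ψ (p ^ 1)        ≡⟨ oddPP p 0 pr p-odd ⟩
    p ^ 0 * (p + 1)  ≡⟨ *-identityˡ (p + 1) ⟩
    p + 1            ∎
    where open ≡-Reasoning

  ψ-^-suc : Prime p → ∀ α → ψ (p ^ suc (suc α)) ≡ p * ψ (p ^ suc α)
  ψ-^-suc {p} pr α with 2 ∣? p
  ... | yes 2∣p with 2∣prime⇒≡2 pr 2∣p
  ...   | refl = trans (twoPP (suc α)) (cong (2 *_) (sym (twoPP α)))
  ψ-^-suc {p} pr α | no p-odd =
    trans (oddPP p (suc α) pr p-odd) (trans (*-assoc p (p ^ α) (p + 1)) (cong (p *_) (sym (oddPP p α pr p-odd))))

  ψ-*-∤ : Prime p → ¬ p ∣ m → ψ (p * m) ≡ ψ p * ψ m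
  ψ-*-∤ {p} {m} pr p∤m = mult p m (prime∤⇒coprime pr p∤m)

  ψ-2*-odd : ¬ 2 ∣ m → ψ (2 * m) ≡ ψ m
  ψ-2*-odd {m} m-odd = trans (ψ-*-∤ prime[2] m-odd) (trans (cong (_* ψ m) (twoPP 0)) (*-identityˡ (ψ m)))

  ψ-oddPrime-*-∤ : Prime p → ¬ 2 ∣ p → ¬ p ∣ m → ψ (p * m) ≡ (p + 1) * ψ m
  ψ-oddPrime-*-∤ {p} {m} pr p-odd p∤m = trans (ψ-*-∤ pr p∤m) (cong (_* ψ m) (ψ-odd-prime pr p-odd))

  ψ-*-∣ : Prime p → 0 < m → p ∣ m → ψ (p * m) ≡ p * ψ m
  ψ-*-∣ {p} {m} pr 0<m p∣m with prime-power-split pr m 0<m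
  ... | zero , m′ , refl , p∤m′ = contradiction (subst (p ∣_) (*-identityˡ m′) p∣m) p∤m′
  ... | suc α , m′ , refl , p∤m′ = begin
    ψ (p * (p ^ suc α * m′))    ≡⟨ cong ψ (sym (*-assoc p (p ^ suc α) m′)) ⟩
    ψ (p ^ suc (suc α) * m′)    ≡⟨ mult _ _ (coprime-^ p⊥m′ (suc (suc α))) ⟩
    ψ (p ^ suc (suc α)) * ψ m′  ≡⟨ cong (_* ψ m′) (ψ-^-suc pr α) ⟩
    p * ψ (p ^ suc α) * ψ m′    ≡⟨ *-assoc p _ _ ⟩
    p * (ψ (p ^ suc α) * ψ m′)  ≡⟨ cong (p *_) (sym (mult _ _ (coprime-^ p⊥m′ (suc α)))) ⟩
    p * ψ (p ^ suc α * m′)      ∎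
    where
      open ≡-Reasoning
      p⊥m′ : Coprime p m′
      p⊥m′ = prime∤⇒coprime pr p∤m′

  height-ψ-oddPrime : Prime p → ¬ 2 ∣ p → Height (p + 1) a → 0 < m →
                      Height (ψ m) c → Height (ψ (p * m)) (a + c)
  height-ψ-oddPrime {p} {m = m} pr p-odd hp+1 0<m hψm with p ∣? m
  ... | yes p∣m = height-cong (sym (ψ-*-∣ pr 0<m p∣m)) (oddPrime pr p-odd hp+1 hψm)
  ... | no p∤m = height-cong (sym (ψ-oddPrime-*-∤ pr p-odd p∤m)) (height-* hp+1 hψm)

  height-ψ-odd : Height n j → ¬ 2 ∣ n → Height (ψ n) j
  height-ψ-odd unit _ = height-cong (sym one) unit
  height-ψ-odd (double {m} _) 2m-odd = contradiction (m∣m*n m) 2m-odd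
  height-ψ-odd (oddPrime {p} pr p-odd hp+1 hm) pm-odd =
    height-ψ-oddPrime pr p-odd hp+1 (height⇒0< hm) (height-ψ-odd hm (pm-odd ∘ ∣n⇒∣m*n p))

  height-ψ-even : Height n j → 2 ∣ n → Height (ψ n) (j ∸ 1)
  height-ψ-even unit 2∣1 = contradiction 2∣1 2∤1
  height-ψ-even (double {m} hm) _ with 2 ∣? m
  ... | no m-odd = height-cong (sym (ψ-2*-odd m-odd)) (height-ψ-odd hm m-odd)
  ... | yes 2∣m = height-cong (sym (ψ-*-∣ prime[2] (height⇒0< hm) 2∣m))
                    (subst (Height _) (m+[n∸m]≡n (even⇒0<height hm 2∣m)) (double (height-ψ-even hm 2∣m)))
  height-ψ-even (oddPrime {a = a} {m} pr p-odd hp+1 hm) 2∣pm =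
    subst (Height _) (sym (+-∸-assoc a (even⇒0<height hm 2∣m)))
      (height-ψ-oddPrime pr p-odd hp+1 (height⇒0< hm) (height-ψ-even hm 2∣m))
    where
      2∣m : 2 ∣ m
      2∣m = 2∣*-oddˡ p-odd 2∣pm

  ψ-even : Height n j → 2 < n → 2 ∣ ψ n
  ψ-even unit (s≤s ())
  ψ-even (double {m} hm) 2<2m with 2 ∣? m
  ... | yes 2∣m = subst (2 ∣_) (sym (ψ-*-∣ prime[2] (height⇒0< hm) 2∣m)) (m∣m*n (ψ m))
  ... | no m-odd = subst (2 ∣_) (sym (ψ-2*-odd m-odd)) (ψ-even hm (odd∧1<⇒2< m-odd (*-cancelˡ-< 2 1 m 2<2m)))
  ψ-even (oddPrime {p} {m = m} pr p-odd _ hm) _ with p ∣? m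
  ... | yes p∣m = subst (2 ∣_) (sym (ψ-*-∣ pr (height⇒0< hm) p∣m)) (∣n⇒∣m*n p (ψ-even hm 2<m))
    where
      2<m : 2 < m
      2<m = <-≤-trans (odd∧1<⇒2< p-odd (prime⇒1< pr)) (∣⇒≤ {{>-nonZero (height⇒0< hm)}} p∣m)
  ... | no p∤m = subst (2 ∣_) (sym (ψ-oddPrime-*-∤ pr p-odd p∤m)) (∣m⇒∣m*n (ψ m) (odd⇒2∣+1 p-odd))

  iter-even : Height n (suc k) → 2 ∣ n → iter ψ k n ≡ 2
  iter-even {k = zero} h _ = height-1 h refl
  iter-even {n = n} {k = suc k} h 2∣n =
    trans (iter-suc ψ k n) (iter-even (height-ψ-even h 2∣n) (ψ-even h (height⇒g′≤ h (s≤s (s≤s z≤n)))))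

  iter-odd : Height n (suc k) → ¬ 2 ∣ n → iter ψ (suc k) n ≡ 2
  iter-odd {n = n} {k = k} h n-odd =
    trans (iter-suc ψ k n) (iter-even (height-ψ-odd h n-odd) (ψ-even h (odd∧1<⇒2< n-odd (height⇒g′≤ h (s≤s z≤n)))))

  height⇒λ-even : Height n (suc k) → 2 ∣ n → IsLambda ψ n k
  height⇒λ-even h 2∣n = inj₂ (height⇒g′≤ h (s≤s z≤n) , iter-even h 2∣n)

  height⇒λ-odd : Height n k → ¬ 2 ∣ n → IsLambda ψ n k
  height⇒λ-odd {k = zero} h _ = inj₁ (height-0 h refl , refl)
  height⇒λ-odd {k = suc k} h n-odd = inj₂ (height⇒g′≤ h (s≤s z≤n) , iter-odd h n-odd)

  λ-unique : IsLambda ψ n k → IsLambda ψ n l → k ≡ l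
  λ-unique = IsLambda-unique one (twoPP 0)

  height-even≡1+λ : Height n j → 2 ∣ n → IsLambda ψ n k → j ≡ suc k
  height-even≡1+λ {j = zero} h 2∣n _ = contradiction (even⇒0<height h 2∣n) λ ()
  height-even≡1+λ {j = suc j} h 2∣n λn = cong suc (λ-unique (height⇒λ-even h 2∣n) λn)

  height-odd≡λ : Height n j → ¬ 2 ∣ n → IsLambda ψ n k → j ≡ k
  height-odd≡λ h n-odd = λ-unique (height⇒λ-odd h n-odd)

  λ⇒height-even : 0 < n → 2 ∣ n → IsLambda ψ n k → Height n (suc k)
  λ⇒height-even {n} 0<n 2∣n λn with ∃-height n 0<n
  ... | j , h = subst (Height n) (height-even≡1+λ h 2∣n λn) h

  λ⇒height-odd : 0 < n → ¬ 2 ∣ n → IsLambda ψ n k → Height n k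
  λ⇒height-odd {n} 0<n n-odd λn with ∃-height n 0<n
  ... | j , h = subst (Height n) (height-odd≡λ h n-odd λn) h

  -- λ(a b) = λ(a) + H(b), except that one is lost when a is odd and b is even.
  cofactor-height : 0 < a → IsLambda ψ a l → 0 < b → IsLambda ψ (a * b) (l + k) →
    (Height b k × (2 ∣ a ⊎ ¬ 2 ∣ b)) ⊎ (¬ 2 ∣ a × ∃ λ c → b ≡ 2 * c × Height c k)
  cofactor-height {a} {l} {b} {k} 0<a λa 0<b λab with 2 ∣? a | ∃-height b 0<b
  ... | yes 2∣a | h , hb = inj₁ (subst (Height b) h≡k hb , inj₁ 2∣a)
    where
      h≡k : h ≡ k
      h≡k = +-cancelˡ-≡ (suc l) h k
              (height-even≡1+λ (height-* (λ⇒height-even 0<a 2∣a λa) hb) (∣m⇒∣m*n b 2∣a) λab)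
  ... | no a-odd | h , hb with 2 ∣? b
  ...   | no b-odd = inj₁ (subst (Height b) h≡k hb , inj₂ b-odd)
    where
      h≡k : h ≡ k
      h≡k = +-cancelˡ-≡ l h k (height-odd≡λ (height-* (λ⇒height-odd 0<a a-odd λa) hb) (odd-* a-odd b-odd) λab)
  ...   | yes 2∣b with cofactor 0<b 2∣b
  ...     | c , 0<c , refl with ∃-height c 0<c
  ...       | x , hc = inj₂ (a-odd , c , refl , subst (Height c) x≡k hc)
    where
      l+[1+x]≡l+[1+k] : l + suc x ≡ l + suc k
      l+[1+x]≡l+[1+k] = trans (height-even≡1+λ (height-* (λ⇒height-odd 0<a a-odd λa) (double hc)) (∣n⇒∣m*n a (m∣m*n c)) λab)
                          (sym (+-suc l k))
      x≡k : x ≡ k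
      x≡k = suc-injective (+-cancelˡ-≡ l (suc x) (suc k) l+[1+x]≡l+[1+k])

  least-multiple : 0 < a → IsLambda ψ a l → 2 ≤ j → l + j ≡ k →
    IsLambda ψ (a * g′ j) k × (∀ n → 0 < n → a ∣ n → IsLambda ψ n k → a * g′ j ≤ n)
  least-multiple {a} {l} {j} 0<a λa 2≤j refl = λag , least
    where
      λag : IsLambda ψ (a * g′ j) (l + j)
      λag with 2 ∣? a
      ... | yes 2∣a = height⇒λ-even (height-* (λ⇒height-even 0<a 2∣a λa) (height-g′ j)) (∣m⇒∣m*n (g′ j) 2∣a)
      ... | no a-odd = height⇒λ-odd (height-* (λ⇒height-odd 0<a a-odd λa) (height-g′ j)) (odd-* a-odd (g′-odd 2≤j))

      least : ∀ n → 0 < n → a ∣ n → IsLambda ψ n (l + j) → a * g′ j ≤ n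
      least n 0<n a∣n λn with cofactor 0<n a∣n
      ... | b , 0<b , refl with cofactor-height 0<a λa 0<b λn
      ...   | inj₁ (hb , _) = *-monoʳ-≤ a (g′-least hb)
      ...   | inj₂ (_ , c , refl , hc) = *-monoʳ-≤ a (≤-trans (g′-least hc) (m≤n*m c 2))

  next-multiple-odd : 0 < a → IsLambda ψ a l → ¬ 2 ∣ a →
    IsLambda ψ (4 * a) (l + 1) × (∀ n → 0 < n → a ∣ n → IsLambda ψ n (l + 1) → n ≡ 4 * a)
  next-multiple-odd {a} {l} 0<a λa a-odd = λ4a , unique
    where
      λ4a : IsLambda ψ (4 * a) (l + 1)
      λ4a = subst₂ (IsLambda ψ) (sym (*-assoc 2 2 a)) (+-comm 1 l)
              (height⇒λ-even (double (double (λ⇒height-odd 0<a a-odd λa))) (m∣m*n (2 * a)))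

      unique : ∀ n → 0 < n → a ∣ n → IsLambda ψ n (l + 1) → n ≡ 4 * a
      unique n 0<n a∣n λn with cofactor 0<n a∣n
      ... | b , 0<b , refl with cofactor-height 0<a λa 0<b λn
      ...   | inj₁ (_ , inj₁ 2∣a) = contradiction 2∣a a-odd
      ...   | inj₁ (hb , inj₂ b-odd) = contradiction (subst (2 ∣_) (sym (height-1 hb refl)) ∣-refl) b-odd
      ...   | inj₂ (_ , c , refl , hc) = trans (cong (λ c → a * (2 * c)) (height-1 hc refl)) (*-comm a 4)

  next-multiple-even : 0 < a → IsLambda ψ a l → 2 ∣ a →
    IsLambda ψ (2 * a) (l + 1) × (∀ n → 0 < n → a ∣ n → IsLambda ψ n (l + 1) → n ≡ 2 * a)
  next-multiple-even {a} {l} 0<a λa 2∣a = λ2a , unique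
    where
      λ2a : IsLambda ψ (2 * a) (l + 1)
      λ2a = subst (IsLambda ψ (2 * a)) (+-comm 1 l) (height⇒λ-even (double (λ⇒height-even 0<a 2∣a λa)) (m∣m*n a))

      unique : ∀ n → 0 < n → a ∣ n → IsLambda ψ n (l + 1) → n ≡ 2 * a
      unique n 0<n a∣n λn with cofactor 0<n a∣n
      ... | b , 0<b , refl with cofactor-height 0<a λa 0<b λn
      ...   | inj₁ (hb , _) = trans (cong (a *_) (height-1 hb refl)) (*-comm a 2)
      ...   | inj₂ (a-odd , _) = contradiction 2∣a a-odd

theorem2p2 : (ψ : ℕ → ℕ) → IsPsiBar ψ →
    (a la : ℕ) → 0 < a → IsLambda ψ a la →
    ((k : ℕ) → la + 1 < k →
      (IsLambda ψ (a * g (k ∸ la)) k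
        × ((n : ℕ) → 0 < n → a ∣ n → IsLambda ψ n k → a * g (k ∸ la) ≤ n)))
    × (¬ (2 ∣ a) →
      (IsLambda ψ (4 * a) (la + 1)
        × ((n : ℕ) → 0 < n → a ∣ n → IsLambda ψ n (la + 1) → n ≡ 4 * a)))
    × (2 ∣ a →
      (IsLambda ψ (2 * a) (la + 1)
        × ((n : ℕ) → 0 < n → a ∣ n → IsLambda ψ n (la + 1) → n ≡ 2 * a)))
theorem2p2 ψ isψ a la 0<a λa = least , next-multiple-odd isψ 0<a λa , next-multiple-even isψ 0<a λa
  where
    least : (k : ℕ) → la + 1 < k →
      IsLambda ψ (a * g (k ∸ la)) k × ((n : ℕ) → 0 < n → a ∣ n → IsLambda ψ n k → a * g (k ∸ la) ≤ n)
    least k la+1<k rewrite g≡g′ (m+1<n⇒2≤n∸m la+1<k) =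
      least-multiple isψ 0<a λa (m+1<n⇒2≤n∸m la+1<k) (m+[n∸m]≡n (≤-trans (m≤m+n la 1) (<⇒≤ la+1<k)))
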